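{- Let $T\subseteq\omega^{<\omega}$ be a uniformly e-pointed tree with respect to functions. Then there is a uniformly e-pointed tree $S\subseteq2^{<\omega}$ with respect to sets such that $S\equiv_{\mathrm e}T$; moreover $S$ may be chosen so that $[S]=\{\chi_{\mathrm{graph}(f)}:f\in[T]\}$.
   Context: Strings are identified with natural numbers via a standard coding; $\equiv_{\mathrm e}$ is enumeration equivalence. $\chi_Z$ is the characteristic function of $Z\subseteq\omega$, and $\mathrm{graph}(f)=\{\langle n,f(n)\rangle:n\in\omega\}$ (Cantor pairing). For $g\in2^\omega$, $g^+=\{n:g(n)=1\}$. For an enumeration operator $\Psi$ and $g\in\omega^\omega$, $\Psi(g)$ means $\Psi(\mathrm{graph}(g))$. A tree is a subset of $\omega^{<\omega}$ closed under initial segments; a leaf is a node with no proper extension in the tree; $[T]$ is the set of infinite paths. A uniformly e-pointed tree with respect to sets is a tree $T\subseteq2^{<\omega}$ with no leaves for which there is an enumeration operator $\Psi$ with $\Psi(g^+)=T$ for all $g\in[T]$. A uniformly e-pointed tree with respect to functions is a finitely branching tree $T\subseteq\omega^{<\omega}$ with no leaves for which there is an enumeration operator $\Psi$ with $\Psi(g)=T$ for all $g\in[T]$. -}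

module Defs where

open import Data.Nat using (ℕ; zero; suc; _+_; _*_; _^_; _<_)
open import Data.Nat.DivMod using (_/_; _%_)
open import Data.Bool using (Bool; true; false)
open import Data.Fin using (Fin)
open import Data.Vec using (Vec; []; _∷_; lookup)
open import Data.List using (List; []; _∷_; _++_; map; applyUpTo)
open import Data.Product using (Σ; ∃; _×_; _,_)
open import Relation.Binary.PropositionalEquality using (_≡_)

SetN : Set₁
SetN = ℕ → Set

_⇔_ : Set → Set → Set
A ⇔ B = (A → B) × (B → A)

_≐_ : SetN → SetN → Set
A ≐ B = ∀ x → A x ⇔ B x

-- Cantor pairing  ⟨x , y⟩ = (x+y)(x+y+1)/2 + y

tri : ℕ → ℕ
tri zero    = 0
tri (suc n) = tri n + suc n

⟨_,_⟩ : ℕ → ℕ → ℕ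
⟨ x , y ⟩ = tri (x + y) + y

-- Standard coding of strings σ ∈ ω^{<ω} (lists, first entry = σ(0))
-- by natural numbers (a bijection List ℕ → ℕ).
code : List ℕ → ℕ
code []      = 0
code (x ∷ σ) = suc ⟨ x , code σ ⟩

b2n : Bool → ℕ
b2n false = 0
b2n true  = 1

codeB : List Bool → ℕ
codeB σ = code (map b2n σ)

codesN : (List ℕ → Set) → SetN
codesN T n = Σ (List ℕ) λ σ → (code σ ≡ n) × T σ

codesB : (List Bool → Set) → SetN
codesB S n = Σ (List Bool) λ σ → (codeB σ ≡ n) × S σ

data PR : ℕ → Set where
  zer  : ∀ {n} → PR n
  succ : PR 1
  proj : ∀ {n} → Fin n → PR n
  comp : ∀ {m n} → PR m → Vec (PR n) m → PR n
  prec : ∀ {n} → PR n → PR (suc (suc n)) → PR (suc n)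

mutual
  eval : ∀ {n} → PR n → Vec ℕ n → ℕ
  eval zer        xs       = 0
  eval succ       (x ∷ []) = suc x
  eval (proj i)   xs       = lookup xs i
  eval (comp f gs) xs      = eval f (evalVec gs xs)
  eval (prec g h) (k ∷ xs) = evalRec g h k xs

  evalVec : ∀ {m n} → Vec (PR n) m → Vec ℕ n → Vec ℕ m
  evalVec []       xs = []
  evalVec (g ∷ gs) xs = eval g xs ∷ evalVec gs xs

  evalRec : ∀ {n} → PR n → PR (suc (suc n)) → ℕ → Vec ℕ n → ℕ
  evalRec g h zero    xs = eval g xs
  evalRec g h (suc k) xs = eval h (k ∷ evalRec g h k xs ∷ xs)

-- The c.e. set W_p = { x : ∃ s, p(x,s) = 0 } given by a primitive
-- recursive p (every c.e. set has this form, Kleene normal form).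
W : PR 2 → SetN
W p x = ∃ λ s → eval p (x ∷ s ∷ []) ≡ 0

bit : ℕ → ℕ → ℕ
bit zero    u = u % 2
bit (suc i) u = bit i (u / 2)

D : ℕ → SetN
D u i = bit i u ≡ 1

_⊆_ : SetN → SetN → Set
A ⊆ B = ∀ x → A x → B x

Ψ : PR 2 → SetN → SetN
Ψ p A x = ∃ λ u → W p ⟨ x , u ⟩ × (D u ⊆ A)

_≤e_ : SetN → SetN → Set
A ≤e B = ∃ λ p → Ψ p B ≐ A

_≡e_ : SetN → SetN → Set
A ≡e B = (A ≤e B) × (B ≤e A)

graph : (ℕ → ℕ) → SetN
graph f x = ∃ λ n → x ≡ ⟨ n , f n ⟩

_⁺ : (ℕ → Bool) → SetN
(g ⁺) n = g n ≡ true

IsChar : (ℕ → Bool) → SetN → Set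
IsChar h A = ∀ x → (h x ≡ true) ⇔ A x

_⊑_ : ∀ {A : Set} → List A → List A → Set
σ ⊑ τ = ∃ λ ρ → σ ++ ρ ≡ τ

IsTree : ∀ {A : Set} → (List A → Set) → Set
IsTree T = ∀ σ τ → T τ → σ ⊑ τ → T σ

NoLeaves : ∀ {A : Set} → (List A → Set) → Set
NoLeaves {A} T = ∀ σ → T σ → ∃ λ (a : A) → T (σ ++ (a ∷ []))

FinitelyBranching : (List ℕ → Set) → Set
FinitelyBranching T = ∀ σ → T σ → ∃ λ b → ∀ n → T (σ ++ (n ∷ [])) → n < b

_↾_ : ∀ {A : Set} → (ℕ → A) → ℕ → List A
g ↾ n = applyUpTo g n

IsPath : ∀ {A : Set} → (List A → Set) → (ℕ → A) → Set
IsPath T g = ∀ n → T (g ↾ n)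

UEPointedSets : (List Bool → Set) → Set
UEPointedSets S =
  IsTree S × NoLeaves S ×
  (∃ λ p → ∀ g → IsPath S g → Ψ p (g ⁺) ≐ codesB S)

UEPointedFuns : (List ℕ → Set) → Set
UEPointedFuns T =
  IsTree T × FinitelyBranching T × NoLeaves T ×
  (∃ λ p → ∀ g → IsPath T g → Ψ p (graph g) ≐ codesN T)

-- S consists of the segments χ_graph(τ) ↾ n with τ ∈ T and n ≤ |τ|; since i ≤ ⟨i,j⟩, such a
-- segment only speaks about entries of τ, and χ_graph(f) ↾ n ∈ S for every f ∈ [T].
-- Conversely, every initial segment of a path h of S agrees with some χ_graph(τ), τ ∈ T, so h
-- is the characteristic function of a single-valued relation.  If b bounds the branching of T
-- after the part of f already read off from h, then h below ⟨i,b⟩ determines f(i) and keeps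
-- f ↾ (i+1) in T; hence h = χ_graph(f) with f ∈ [T].  S ≤e T: compute χ_graph(τ) ↾ n from
-- the code of τ.  T ≤e S: τ ∈ T iff χ_graph(τ′) ↾ (1 + ⟨code τ, code τ⟩) ∈ S for some τ′
-- extending τ (T has no leaves), because a segment of that length already determines τ.
-- For h = χ_graph(f) we have h⁺ = graph f, so composing S ≤e T with the uniform operator of T
-- makes S uniformly e-pointed.

module Submission where

open import Defs
open import Data.Bool using (Bool; true; false; T)
open import Data.Unit using (tt)
open import Data.Bool.Properties using (¬-not)
open import Data.Empty using (⊥-elim)
open import Function using (_∘_)
open import Data.Nat using (ℕ; zero; suc; _+_; _∸_; _^_; _≤_; _<_; z≤n; s≤s; pred; ∣_-_∣)
open import Data.Nat.Properties
open import Data.Nat.DivMod using (_/_; _%_; m*n%n≡0; m*n/n≡m)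
open import Data.Nat.Induction using (<-rec)
open import Data.Fin using (Fin; #_)
open import Data.Vec using (Vec; []; _∷_; lookup)
open import Data.List using (List; []; _∷_; _++_; applyUpTo; length; take; drop)
open import Data.List.Properties
  using (∷-injectiveˡ; ∷-injectiveʳ; map-injective; length-++; length-++-≤ˡ; ++-identityʳ; ++-assoc;
         length-applyUpTo; applyUpTo-∷ʳ; map-applyUpTo; take-all; take++drop≡id)
open import Data.Product using (Σ; ∃; _×_; _,_; proj₁; proj₂)
open import Data.Sum using (inj₁; inj₂)
open import Relation.Nullary using (yes; no; does)
open import Relation.Nullary.Decidable using (dec-true; dec-false)
open import Relation.Binary.Definitions using (tri<; tri≈; tri>)
open import Relation.Binary.PropositionalEquality

isZero : ℕ → ℕ
isZero zero    = 1
isZero (suc _) = 0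

isZero-∣-∣ : ∀ a b → isZero ∣ a - b ∣ ≡ b2n (does (a ≟ b))
isZero-∣-∣ zero    zero    = refl
isZero-∣-∣ zero    (suc b) = refl
isZero-∣-∣ (suc a) zero    = refl
isZero-∣-∣ (suc a) (suc b) = isZero-∣-∣ a b

∸+∸≡∣-∣ : ∀ a b → (a ∸ b) + (b ∸ a) ≡ ∣ a - b ∣
∸+∸≡∣-∣ zero    zero    = refl
∸+∸≡∣-∣ zero    (suc b) = refl
∸+∸≡∣-∣ (suc a) zero    = +-identityʳ (suc a)
∸+∸≡∣-∣ (suc a) (suc b) = ∸+∸≡∣-∣ a b

n≤tri : ∀ n → n ≤ tri n
n≤tri zero    = z≤n
n≤tri (suc n) = m≤n+m (suc n) (tri n)

tri-mono-≤ : ∀ {a b} → a ≤ b → tri a ≤ tri b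
tri-mono-≤ z≤n       = z≤n
tri-mono-≤ (s≤s a≤b) = +-mono-≤ (tri-mono-≤ a≤b) (s≤s a≤b)

-- diag ⟨ a , b ⟩ = a + b: diag steps up exactly at the triangular numbers.
diag : ℕ → ℕ
diag zero    = 0
diag (suc k) = diag k + b2n (does (suc k ≟ tri (suc (diag k))))

diag-bounds : ∀ k → tri (diag k) ≤ k × k ≤ tri (diag k) + diag k
diag-bounds zero = z≤n , z≤n
diag-bounds (suc k) with diag-bounds k | suc k ≟ tri (suc (diag k))
... | _ , _ | yes k+1≡ rewrite dec-true (suc k ≟ tri (suc (diag k))) k+1≡ | +-comm (diag k) 1 =
  ≤-reflexive (sym k+1≡) , ≤-trans (≤-reflexive k+1≡) (m≤m+n _ _)
... | lower , upper | no k+1≢ rewrite dec-false (suc k ≟ tri (suc (diag k))) k+1≢ | +-identityʳ (diag k) =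
  ≤-trans lower (n≤1+n k) , m<1+n⇒m≤n (subst (suc k <_) (+-suc _ _) k+1<)
  where
  k+1< : suc k < tri (suc (diag k))
  k+1< = ≤∧≢⇒< (≤-trans (s≤s upper) (≤-reflexive (sym (+-suc _ _)))) k+1≢

diag-unique : ∀ {d e k} → tri d ≤ k → k ≤ tri d + d → tri e ≤ k → k ≤ tri e + e → d ≡ e
diag-unique {d} {e} l₁ u₁ l₂ u₂ with <-cmp d e
... | tri≈ _ d≡e _ = d≡e
... | tri< d<e _ _ = ⊥-elim (<⇒≱ (≤-<-trans u₁ (subst (_≤ tri e) (+-suc _ d) (tri-mono-≤ d<e))) l₂)
... | tri> _ _ e<d = ⊥-elim (<⇒≱ (≤-<-trans u₂ (subst (_≤ tri d) (+-suc _ e) (tri-mono-≤ e<d))) l₁)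

diag-⟨,⟩ : ∀ a b → diag ⟨ a , b ⟩ ≡ a + b
diag-⟨,⟩ a b = diag-unique (proj₁ (diag-bounds _)) (proj₂ (diag-bounds _))
  (m≤m+n _ b) (+-monoʳ-≤ (tri (a + b)) (m≤n+m b a))

unpair₁ unpair₂ : ℕ → ℕ
unpair₂ k = k ∸ tri (diag k)
unpair₁ k = diag k ∸ unpair₂ k

unpair₂-⟨,⟩ : ∀ a b → unpair₂ ⟨ a , b ⟩ ≡ b
unpair₂-⟨,⟩ a b rewrite diag-⟨,⟩ a b = m+n∸m≡n (tri (a + b)) b

unpair₁-⟨,⟩ : ∀ a b → unpair₁ ⟨ a , b ⟩ ≡ a
unpair₁-⟨,⟩ a b rewrite unpair₂-⟨,⟩ a b | diag-⟨,⟩ a b = m+n∸n≡m a b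

unpair₂≤diag : ∀ k → unpair₂ k ≤ diag k
unpair₂≤diag k = ≤-trans (∸-monoˡ-≤ (tri (diag k)) (proj₂ (diag-bounds k)))
                         (≤-reflexive (m+n∸m≡n (tri (diag k)) (diag k)))

⟨,⟩-unpair : ∀ k → ⟨ unpair₁ k , unpair₂ k ⟩ ≡ k
⟨,⟩-unpair k rewrite m∸n+n≡m (unpair₂≤diag k) = m+[n∸m]≡n (proj₁ (diag-bounds k))

⟨,⟩-injective : ∀ {a b c d} → ⟨ a , b ⟩ ≡ ⟨ c , d ⟩ → a ≡ c × b ≡ d
⟨,⟩-injective {a} {b} {c} {d} e =
  trans (sym (unpair₁-⟨,⟩ a b)) (trans (cong unpair₁ e) (unpair₁-⟨,⟩ c d)) ,
  trans (sym (unpair₂-⟨,⟩ a b)) (trans (cong unpair₂ e) (unpair₂-⟨,⟩ c d))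

unpair₁-≤ : ∀ k → unpair₁ k ≤ k
unpair₁-≤ k = ≤-trans (m∸n≤m (diag k) (unpair₂ k)) (≤-trans (n≤tri (diag k)) (proj₁ (diag-bounds k)))

unpair₂-≤ : ∀ k → unpair₂ k ≤ k
unpair₂-≤ k = m∸n≤m k (tri (diag k))

m≤⟨m,n⟩ : ∀ a b → a ≤ ⟨ a , b ⟩
m≤⟨m,n⟩ a b = ≤-trans (≤-trans (m≤m+n a b) (n≤tri (a + b))) (m≤m+n _ b)

n≤⟨m,n⟩ : ∀ a b → b ≤ ⟨ a , b ⟩
n≤⟨m,n⟩ a b = m≤n+m b (tri (a + b))

⟨,⟩-mono-≤ : ∀ {a b c d} → a ≤ c → b ≤ d → ⟨ a , b ⟩ ≤ ⟨ c , d ⟩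
⟨,⟩-mono-≤ a≤c b≤d = +-mono-≤ (tri-mono-≤ (+-mono-≤ a≤c b≤d)) b≤d

⟨,⟩-monoʳ-< : ∀ a {b c} → b < c → ⟨ a , b ⟩ < ⟨ a , c ⟩
⟨,⟩-monoʳ-< a b<c = +-mono-≤-< (tri-mono-≤ (+-monoʳ-≤ a (<⇒≤ b<c))) b<c

infixl 9 _!_

_!_ : List ℕ → ℕ → ℕ
[]      ! _     = 0
(x ∷ σ) ! zero  = x
(x ∷ σ) ! suc i = σ ! i

hd tl : ℕ → ℕ
hd c = unpair₁ (pred c)
tl c = unpair₂ (pred c)

tl^ : ℕ → ℕ → ℕ
tl^ zero    c = c
tl^ (suc j) c = tl (tl^ j c)

entry : ℕ → ℕ → ℕ
entry c i = hd (tl^ i c)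

tl-code-drop : ∀ j τ → tl (code (drop j τ)) ≡ code (drop (suc j) τ)
tl-code-drop zero    []      = refl
tl-code-drop zero    (x ∷ τ) = unpair₂-⟨,⟩ x (code τ)
tl-code-drop (suc j) []      = refl
tl-code-drop (suc j) (x ∷ τ) = tl-code-drop j τ

tl^-code : ∀ j τ → tl^ j (code τ) ≡ code (drop j τ)
tl^-code zero    τ = refl
tl^-code (suc j) τ = trans (cong tl (tl^-code j τ)) (tl-code-drop j τ)

hd-code-drop : ∀ i τ → hd (code (drop i τ)) ≡ τ ! i
hd-code-drop zero    []      = refl
hd-code-drop zero    (x ∷ τ) = unpair₁-⟨,⟩ x (code τ)
hd-code-drop (suc i) []      = refl
hd-code-drop (suc i) (x ∷ τ) = hd-code-drop i τ

entry-code : ∀ τ i → entry (code τ) i ≡ τ ! i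
entry-code τ i = trans (cong hd (tl^-code i τ)) (hd-code-drop i τ)

code-injective : ∀ σ τ → code σ ≡ code τ → σ ≡ τ
code-injective []      []      _ = refl
code-injective (x ∷ σ) (y ∷ τ) e with ⟨,⟩-injective (suc-injective e)
... | x≡y , σ≡τ = cong₂ _∷_ x≡y (code-injective σ τ σ≡τ)

b2n-injective : ∀ {a b} → b2n a ≡ b2n b → a ≡ b
b2n-injective {false} {false} _ = refl
b2n-injective {true}  {true}  _ = refl

codeB-injective : ∀ σ τ → codeB σ ≡ codeB τ → σ ≡ τ
codeB-injective σ τ e = map-injective b2n-injective (code-injective _ _ e)

code-surjective : ∀ c → ∃ λ τ → code τ ≡ c
code-surjective = <-rec _ decode
  where
  decode : ∀ c → (∀ {d} → d < c → ∃ λ τ → code τ ≡ d) → ∃ λ τ → code τ ≡ c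
  decode zero    _   = [] , refl
  decode (suc k) rec with rec (s≤s (unpair₂-≤ k))
  ... | τ , τ≡ = unpair₁ k ∷ τ , cong suc (trans (cong ⟨ unpair₁ k ,_⟩ τ≡) (⟨,⟩-unpair k))

length≤code : ∀ σ → length σ ≤ code σ
length≤code []      = z≤n
length≤code (x ∷ σ) = s≤s (≤-trans (length≤code σ) (n≤⟨m,n⟩ x (code σ)))

!≤code : ∀ σ i → σ ! i ≤ code σ
!≤code []      i       = z≤n
!≤code (x ∷ σ) zero    = ≤-trans (m≤⟨m,n⟩ x (code σ)) (n≤1+n _)
!≤code (x ∷ σ) (suc i) = ≤-trans (!≤code σ i) (≤-trans (n≤⟨m,n⟩ x (code σ)) (n≤1+n _))

⟨i,σ!i⟩≤⟨code,code⟩ : ∀ σ i → i < length σ → ⟨ i , σ ! i ⟩ ≤ ⟨ code σ , code σ ⟩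
⟨i,σ!i⟩≤⟨code,code⟩ σ i i<len = ⟨,⟩-mono-≤ (<⇒≤ (<-≤-trans i<len (length≤code σ))) (!≤code σ i)

-- 0 exactly when the string coded by c has length at least n
lengthBelow : ℕ → ℕ → ℕ
lengthBelow c n = isZero (isZero n + tl^ (pred n) c)

isZero-code-drop≡0⇒< : ∀ n τ → isZero (code (drop n τ)) ≡ 0 → n < length τ
isZero-code-drop≡0⇒< zero    (x ∷ τ) _ = s≤s z≤n
isZero-code-drop≡0⇒< (suc n) (x ∷ τ) e = s≤s (isZero-code-drop≡0⇒< n τ e)

<⇒isZero-code-drop≡0 : ∀ n τ → n < length τ → isZero (code (drop n τ)) ≡ 0
<⇒isZero-code-drop≡0 zero    (x ∷ τ) _         = refl
<⇒isZero-code-drop≡0 (suc n) (x ∷ τ) (s≤s n<) = <⇒isZero-code-drop≡0 n τ n<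

lengthBelow≡0⇒≤ : ∀ τ n → lengthBelow (code τ) n ≡ 0 → n ≤ length τ
lengthBelow≡0⇒≤ τ zero    _ = z≤n
lengthBelow≡0⇒≤ τ (suc n) e rewrite tl^-code n τ = isZero-code-drop≡0⇒< n τ e

≤⇒lengthBelow≡0 : ∀ τ n → n ≤ length τ → lengthBelow (code τ) n ≡ 0
≤⇒lengthBelow≡0 τ zero    _   = refl
≤⇒lengthBelow≡0 τ (suc n) n< rewrite tl^-code n τ = <⇒isZero-code-drop≡0 n τ n<

applyUpTo-cong : ∀ {A : Set} (f g : ℕ → A) n → (∀ k → k < n → f k ≡ g k) → f ↾ n ≡ g ↾ n
applyUpTo-cong f g zero    _   = refl
applyUpTo-cong f g (suc n) f≡g =
  cong₂ _∷_ (f≡g 0 (s≤s z≤n)) (applyUpTo-cong (f ∘ suc) (g ∘ suc) n (λ k k< → f≡g (suc k) (s≤s k<)))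

applyUpTo-injective : ∀ {A : Set} (f g : ℕ → A) n → f ↾ n ≡ g ↾ n → ∀ k → k < n → f k ≡ g k
applyUpTo-injective f g (suc n) e zero    _        = ∷-injectiveˡ e
applyUpTo-injective f g (suc n) e (suc k) (s≤s k<) = applyUpTo-injective (f ∘ suc) (g ∘ suc) n (∷-injectiveʳ e) k k<

++≡applyUpTo⇒ : ∀ {A : Set} (f : ℕ → A) n (σ ρ : List A) → σ ++ ρ ≡ f ↾ n → σ ≡ f ↾ length σ
++≡applyUpTo⇒ f n       []      ρ _ = refl
++≡applyUpTo⇒ f (suc n) (x ∷ σ) ρ e = cong₂ _∷_ (∷-injectiveˡ e) (++≡applyUpTo⇒ (f ∘ suc) n σ ρ (∷-injectiveʳ e))

!-applyUpTo : ∀ (f : ℕ → ℕ) n i → i < n → (f ↾ n) ! i ≡ f i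
!-applyUpTo f (suc n) zero    _        = refl
!-applyUpTo f (suc n) (suc i) (s≤s i<) = !-applyUpTo (f ∘ suc) n i i<

!-++ˡ : ∀ σ ρ i → i < length σ → (σ ++ ρ) ! i ≡ σ ! i
!-++ˡ (x ∷ σ) ρ zero    _        = refl
!-++ˡ (x ∷ σ) ρ (suc i) (s≤s i<) = !-++ˡ σ ρ i i<

!-length-∷ʳ : ∀ σ a → (σ ++ a ∷ []) ! length σ ≡ a
!-length-∷ʳ []      a = refl
!-length-∷ʳ (x ∷ σ) a = !-length-∷ʳ σ a

applyUpTo-! : ∀ τ m → m ≤ length τ → (τ !_) ↾ m ≡ take m τ
applyUpTo-! τ       zero    _        = refl
applyUpTo-! (x ∷ τ) (suc m) (s≤s m≤) = cong (x ∷_) (applyUpTo-! τ m m≤)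

applyUpTo-!-length : ∀ τ → (τ !_) ↾ length τ ≡ τ
applyUpTo-!-length τ = trans (applyUpTo-! τ (length τ) ≤-refl) (take-all (length τ) τ ≤-refl)

applyUpTo-!∈ : ∀ {T : List ℕ → Set} → IsTree T → ∀ τ m → T τ → m ≤ length τ → T ((τ !_) ↾ m)
applyUpTo-!∈ tree τ m τ∈T m≤ =
  tree _ τ τ∈T (drop m τ , trans (cong (_++ drop m τ) (applyUpTo-! τ m m≤)) (take++drop≡id m τ))

bit-0 : ∀ i → bit i 0 ≡ 0
bit-0 zero    = refl
bit-0 (suc i) = bit-0 i

2^[1+c]/2≡2^c : ∀ c → 2 ^ suc c / 2 ≡ 2 ^ c
2^[1+c]/2≡2^c c = trans (cong (_/ 2) (*-comm 2 (2 ^ c))) (m*n/n≡m (2 ^ c) 2)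

2^[1+c]%2≡0 : ∀ c → 2 ^ suc c % 2 ≡ 0
2^[1+c]%2≡0 c = trans (cong (_% 2) (*-comm 2 (2 ^ c))) (m*n%n≡0 (2 ^ c) 2)

bit-2^-self : ∀ c → bit c (2 ^ c) ≡ 1
bit-2^-self zero    = refl
bit-2^-self (suc c) = trans (cong (bit c) (2^[1+c]/2≡2^c c)) (bit-2^-self c)

bit-2^ : ∀ i c → bit i (2 ^ c) ≡ 1 → i ≡ c
bit-2^ zero    zero    _ = refl
bit-2^ (suc i) zero    e with trans (sym (bit-0 i)) e
... | ()
bit-2^ zero    (suc c) e with trans (sym (2^[1+c]%2≡0 c)) e
... | ()
bit-2^ (suc i) (suc c) e = cong suc (bit-2^ i c (trans (cong (bit i) (sym (2^[1+c]/2≡2^c c))) e))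

D-2^⊆⇔ : ∀ (A : SetN) c → (D (2 ^ c) ⊆ A) ⇔ A c
D-2^⊆⇔ A c = (λ D⊆A → D⊆A c (bit-2^-self c)) , (λ c∈A i i∈D → subst A (sym (bit-2^ i c i∈D)) c∈A)

χ-graph : List ℕ → ℕ → Bool
χ-graph τ k = does (τ ! unpair₁ k ≟ unpair₂ k)

χ-graph-self : ∀ τ i → χ-graph τ ⟨ i , τ ! i ⟩ ≡ true
χ-graph-self τ i = dec-true (τ ! unpair₁ ⟨ i , τ ! i ⟩ ≟ unpair₂ ⟨ i , τ ! i ⟩)
  (trans (cong (τ !_) (unpair₁-⟨,⟩ i _)) (sym (unpair₂-⟨,⟩ i _)))

χ-graph-true : ∀ τ k → χ-graph τ k ≡ true → τ ! unpair₁ k ≡ unpair₂ k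
χ-graph-true τ k e = ≡ᵇ⇒≡ (τ ! unpair₁ k) (unpair₂ k) (subst T (sym e) tt)

χ-graph-⟨,⟩ : ∀ τ i j → χ-graph τ ⟨ i , j ⟩ ≡ true → τ ! i ≡ j
χ-graph-⟨,⟩ τ i j e =
  trans (cong (τ !_) (sym (unpair₁-⟨,⟩ i j))) (trans (χ-graph-true τ ⟨ i , j ⟩ e) (unpair₂-⟨,⟩ i j))

length-∷ʳ : ∀ {A : Set} (σ : List A) a → length (σ ++ a ∷ []) ≡ suc (length σ)
length-∷ʳ []      a = refl
length-∷ʳ (x ∷ σ) a = cong suc (length-∷ʳ σ a)

χTree : (List ℕ → Set) → List Bool → Set
χTree T σ = ∃ λ τ → T τ × length σ ≤ length τ × σ ≡ χ-graph τ ↾ length σ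

χ-graph-++ : ∀ τ ρ k → k < length τ → χ-graph (τ ++ ρ) k ≡ χ-graph τ k
χ-graph-++ τ ρ k k< = cong (λ a → does (a ≟ unpair₂ k)) (!-++ˡ τ ρ (unpair₁ k) (≤-<-trans (unpair₁-≤ k) k<))

χTree-isTree : ∀ T → IsTree (χTree T)
χTree-isTree T σ σ′ (τ , τ∈T , σ′≤ , σ′≡) (ρ , σρ≡σ′) =
  τ , τ∈T , ≤-trans (≤-trans (length-++-≤ˡ σ) (≤-reflexive (cong length σρ≡σ′))) σ′≤ ,
  ++≡applyUpTo⇒ (χ-graph τ) (length σ′) σ ρ (trans σρ≡σ′ σ′≡)

χTree-noLeaves : ∀ {T} → NoLeaves T → NoLeaves (χTree T)
χTree-noLeaves noLeaves σ (τ , τ∈T , σ≤ , σ≡) with noLeaves τ τ∈T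
... | a , τa∈T = b , τa , τa∈T , σb≤ , σb≡
  where
  τa : List ℕ
  τa = τ ++ a ∷ []
  n : ℕ
  n = length σ
  b : Bool
  b = χ-graph τa n
  σb≤ : length (σ ++ b ∷ []) ≤ length τa
  σb≤ = subst₂ _≤_ (sym (length-∷ʳ σ b)) (sym (length-∷ʳ τ a)) (s≤s σ≤)
  σ≡′ : σ ≡ χ-graph τa ↾ n
  σ≡′ = trans σ≡ (applyUpTo-cong _ _ n (λ k k< → sym (χ-graph-++ τ (a ∷ []) k (<-≤-trans k< σ≤))))
  σb≡ : σ ++ b ∷ [] ≡ χ-graph τa ↾ length (σ ++ b ∷ [])
  σb≡ = begin
    σ ++ b ∷ []               ≡⟨ cong (_++ b ∷ []) σ≡′ ⟩
    χ-graph τa ↾ n ++ b ∷ []  ≡⟨ applyUpTo-∷ʳ (χ-graph τa) n ⟩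
    χ-graph τa ↾ suc n        ≡⟨ cong (χ-graph τa ↾_) (sym (length-∷ʳ σ b)) ⟩
    χ-graph τa ↾ length (σ ++ b ∷ []) ∎
    where open ≡-Reasoning

graph⇒unpair : ∀ {f k} → graph f k → f (unpair₁ k) ≡ unpair₂ k
graph⇒unpair {f} (n , refl) rewrite unpair₁-⟨,⟩ n (f n) | unpair₂-⟨,⟩ n (f n) = refl

IsChar-graph⇒ : ∀ {h f} → IsChar h (graph f) → ∀ k → h k ≡ does (f (unpair₁ k) ≟ unpair₂ k)
IsChar-graph⇒ {h} {f} h-char k with f (unpair₁ k) ≟ unpair₂ k
... | yes e = trans (proj₂ (h-char k) (unpair₁ k , trans (sym (⟨,⟩-unpair k)) (cong ⟨ unpair₁ k ,_⟩ (sym e))))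
                  (sym (dec-true (f (unpair₁ k) ≟ unpair₂ k) e))
... | no ne = trans (¬-not (λ hk → ne (graph⇒unpair (proj₁ (h-char k) hk))))
                  (sym (dec-false (f (unpair₁ k) ≟ unpair₂ k) ne))

χTree-path-of-graph : ∀ {T} f h → IsPath T f → IsChar h (graph f) → IsPath (χTree T) h
χTree-path-of-graph f h f∈[T] h-char n =
  f ↾ n , f∈[T] n , ≤-reflexive (trans (length-applyUpTo h n) (sym (length-applyUpTo f n))) ,
  trans (applyUpTo-cong _ _ n h≡χ) (cong (χ-graph (f ↾ n) ↾_) (sym (length-applyUpTo h n)))
  where
  h≡χ : ∀ k → k < n → h k ≡ χ-graph (f ↾ n) k
  h≡χ k k< = trans (IsChar-graph⇒ h-char k)
    (cong (λ a → does (a ≟ unpair₂ k)) (sym (!-applyUpTo f n (unpair₁ k) (≤-<-trans (unpair₁-≤ k) k<))))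

-- Agreement below N covers the graph of ρ, since ⟨ code ρ , code ρ ⟩ bounds every ⟨ i , ρ ! i ⟩
-- with i < length ρ.
χ-agreement⇒≡applyUpTo : ∀ (g : ℕ → Bool) τ ρ N → (∀ k → k < N → g k ≡ χ-graph τ k) →
  ⟨ code ρ , code ρ ⟩ < N → (∀ i → i < length ρ → g ⟨ i , ρ ! i ⟩ ≡ true) → ρ ≡ (τ !_) ↾ length ρ
χ-agreement⇒≡applyUpTo g τ ρ N g≡χ bound ρ⊆g =
  trans (sym (applyUpTo-!-length ρ)) (applyUpTo-cong _ _ (length ρ) ρ!i≡τ!i)
  where
  ρ!i≡τ!i : ∀ i → i < length ρ → ρ ! i ≡ τ ! i
  ρ!i≡τ!i i i< = sym (χ-graph-⟨,⟩ τ i (ρ ! i)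
    (trans (sym (g≡χ _ (≤-<-trans (⟨i,σ!i⟩≤⟨code,code⟩ ρ i i<) bound))) (ρ⊆g i i<)))

χ-graph↾∈χTree : ∀ {T τ n} → T τ → n ≤ length τ → χTree T (χ-graph τ ↾ n)
χ-graph↾∈χTree {τ = τ} {n} τ∈T n≤ =
  τ , τ∈T , subst (_≤ length τ) (sym (length-applyUpTo _ n)) n≤ ,
  cong (χ-graph τ ↾_) (sym (length-applyUpTo _ n))

χTree-agreeing : ∀ {T} (g : ℕ → Bool) N → χTree T (g ↾ N) →
  ∃ λ τ → T τ × N ≤ length τ × (∀ k → k < N → g k ≡ χ-graph τ k)
χTree-agreeing g N (τ , τ∈T , N≤ , g↾N≡) =
  τ , τ∈T , subst (_≤ length τ) (length-applyUpTo g N) N≤ ,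
  applyUpTo-injective g (χ-graph τ) N (trans g↾N≡ (cong (χ-graph τ ↾_) (length-applyUpTo g N)))

extendBy : ∀ {T : List ℕ → Set} → NoLeaves T → ∀ τ → T τ → ∀ k → ∃ λ ρ → T (τ ++ ρ) × length ρ ≡ k
extendBy {T} noLeaves τ τ∈T zero = [] , subst T (sym (++-identityʳ τ)) τ∈T , refl
extendBy {T} noLeaves τ τ∈T (suc k) with noLeaves τ τ∈T
... | a , τa∈T with extendBy noLeaves (τ ++ a ∷ []) τa∈T k
...   | ρ , τaρ∈T , length≡k = a ∷ ρ , subst T (++-assoc τ (a ∷ []) ρ) τaρ∈T , cong suc length≡k

module χTreePath (T : List ℕ → Set) (tree : IsTree T) (finBranching : FinitelyBranching T)
                 (h : ℕ → Bool) (h∈[χTree] : IsPath (χTree T) h) where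

  agreeing : ∀ N → ∃ λ τ → T τ × N ≤ length τ × (∀ k → k < N → h k ≡ χ-graph τ k)
  agreeing N = χTree-agreeing h N (h∈[χTree] N)

  h-functional : ∀ {i j j′} → h ⟨ i , j ⟩ ≡ true → h ⟨ i , j′ ⟩ ≡ true → j ≡ j′
  h-functional {i} {j} {j′} hj hj′ with agreeing (suc (⟨ i , j ⟩ + ⟨ i , j′ ⟩))
  ... | τ , _ , _ , h≡χ =
    trans (sym (χ-graph-⟨,⟩ τ i j (trans (sym (h≡χ _ (s≤s (m≤m+n _ _)))) hj)))
          (χ-graph-⟨,⟩ τ i j′ (trans (sym (h≡χ _ (s≤s (m≤n+m _ ⟨ i , j ⟩)))) hj′))

  record Approximation (i : ℕ) : Set where
    field
      string   : List ℕ
      string∈T : T string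
      length≡  : length string ≡ i
      graph⊆h  : ∀ m → m < i → h ⟨ m , string ! m ⟩ ≡ true
  open Approximation

  -- τ agrees with h below a bound exceeding the graph of ρ and every ⟨ i , a ⟩ with a
  -- below the branching bound b; so τ extends ρ, and h contains ⟨ i , τ ! i ⟩.
  extension : ∀ i (ρ : Approximation i) → ∃ λ a → T (string ρ ++ a ∷ []) × h ⟨ i , a ⟩ ≡ true
  extension i ρ with finBranching (string ρ) (string∈T ρ)
  ... | b , below-b with agreeing (suc (⟨ i , b ⟩ + ⟨ code (string ρ) , code (string ρ) ⟩))
  ...   | τ , τ∈T , N≤ , h≡χ = τ ! i , ρa∈T , h⟨i,a⟩
    where
    ρ≡ : string ρ ≡ (τ !_) ↾ i
    ρ≡ = trans (χ-agreement⇒≡applyUpTo h τ (string ρ) _ h≡χ (s≤s (m≤n+m _ ⟨ i , b ⟩))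
                  (λ m m< → graph⊆h ρ m (subst (m <_) (length≡ ρ) m<)))
               (cong ((τ !_) ↾_) (length≡ ρ))
    i<|τ| : i < length τ
    i<|τ| = <-≤-trans (≤-<-trans (m≤⟨m,n⟩ i b) (s≤s (m≤m+n _ _))) N≤
    ρa∈T : T (string ρ ++ τ ! i ∷ [])
    ρa∈T = subst T (sym (trans (cong (_++ τ ! i ∷ []) ρ≡) (applyUpTo-∷ʳ (τ !_) i)))
                 (applyUpTo-!∈ tree τ (suc i) τ∈T i<|τ|)
    h⟨i,a⟩ : h ⟨ i , τ ! i ⟩ ≡ true
    h⟨i,a⟩ = trans (h≡χ _ (<-trans (⟨,⟩-monoʳ-< i (below-b _ ρa∈T)) (s≤s (m≤m+n _ _)))) (χ-graph-self τ i)

  approximation : ∀ i → Approximation i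
  approximation zero with agreeing 0
  ... | τ , τ∈T , _ = record
    { string = [] ; string∈T = tree [] τ τ∈T (τ , refl) ; length≡ = refl ; graph⊆h = λ _ () }
  approximation (suc i) with approximation i | extension i (approximation i)
  ... | ρ | a , ρa∈T , h⟨i,a⟩ = record
    { string = string ρ ++ a ∷ [] ; string∈T = ρa∈T
    ; length≡ = trans (length-∷ʳ (string ρ) a) (cong suc (length≡ ρ)) ; graph⊆h = graph⊆h′ }
    where
    graph⊆h′ : ∀ m → m < suc i → h ⟨ m , (string ρ ++ a ∷ []) ! m ⟩ ≡ true
    graph⊆h′ m (s≤s m≤i) with m≤n⇒m<n∨m≡n m≤i
    ... | inj₁ m<i  = trans (cong (λ x → h ⟨ m , x ⟩) (!-++ˡ (string ρ) _ m (subst (m <_) (sym (length≡ ρ)) m<i)))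
                            (graph⊆h ρ m m<i)
    ... | inj₂ refl = trans (cong (λ x → h ⟨ m , x ⟩) (trans (cong ((string ρ ++ a ∷ []) !_) (sym (length≡ ρ)))
                                                             (!-length-∷ʳ (string ρ) a)))
                            h⟨i,a⟩

  f : ℕ → ℕ
  f i = proj₁ (extension i (approximation i))

  f↾≡string : ∀ n → f ↾ n ≡ string (approximation n)
  f↾≡string zero    = refl
  f↾≡string (suc n) = trans (sym (applyUpTo-∷ʳ f n)) (cong (_++ f n ∷ []) (f↾≡string n))

  f∈[T] : IsPath T f
  f∈[T] n = subst T (sym (f↾≡string n)) (string∈T (approximation n))

  h-char : IsChar h (graph f)
  h-char x =
    (λ hx → unpair₁ x ,
            trans (sym (⟨,⟩-unpair x)) (cong ⟨ unpair₁ x ,_⟩ (h-functional {unpair₁ x} (hx′ hx) h⟨i,fi⟩))) ,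
    λ { (i , refl) → proj₂ (proj₂ (extension i (approximation i))) }
    where
    hx′ : h x ≡ true → h ⟨ unpair₁ x , unpair₂ x ⟩ ≡ true
    hx′ = subst (λ y → h y ≡ true) (sym (⟨,⟩-unpair x))
    h⟨i,fi⟩ : h ⟨ unpair₁ x , f (unpair₁ x) ⟩ ≡ true
    h⟨i,fi⟩ = proj₂ (proj₂ (extension (unpair₁ x) (approximation (unpair₁ x))))

singleton⊆codesB : ∀ (S : List Bool → Set) σ → D (2 ^ codeB σ) ⊆ codesB S → S σ
singleton⊆codesB S σ D⊆S with proj₁ (D-2^⊆⇔ (codesB S) (codeB σ)) D⊆S
... | σ′ , codeBσ′≡ , σ′∈S = subst S (codeB-injective σ′ σ codeBσ′≡) σ′∈S

-- R x u s ≡ 0 says that s witnesses the axiom "x is enumerated from D u".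
ΨRel : (ℕ → ℕ → ℕ → ℕ) → SetN → SetN
ΨRel R A x = ∃ λ u → (∃ λ s → R x u s ≡ 0) × D u ⊆ A

axiomsOf : PR 2 → ℕ → ℕ → ℕ → ℕ
axiomsOf p x u s = eval p (⟨ x , u ⟩ ∷ s ∷ [])

≐-trans : ∀ {A B C : SetN} → A ≐ B → B ≐ C → A ≐ C
≐-trans A≐B B≐C x = proj₁ (B≐C x) ∘ proj₁ (A≐B x) , proj₂ (A≐B x) ∘ proj₂ (B≐C x)

Ψ-cong : ∀ p {A B} → A ≐ B → Ψ p A ≐ Ψ p B
Ψ-cong p A≐B x = (λ { (u , ax , D⊆A) → u , ax , λ i i∈D → proj₁ (A≐B i) (D⊆A i i∈D) }) ,
                 (λ { (u , ax , D⊆B) → u , ax , λ i i∈D → proj₂ (A≐B i) (D⊆B i i∈D) })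

idAxioms : ℕ → ℕ → ℕ → ℕ
idAxioms x u s = ∣ x - s ∣ + ∣ u - 2 ^ s ∣

ΨRel-idAxioms : ∀ A → ΨRel idAxioms A ≐ A
ΨRel-idAxioms A x = sound , complete
  where
  sound : ΨRel idAxioms A x → A x
  sound (u , (s , e) , D⊆A) = subst A (sym x≡s) (proj₁ (D-2^⊆⇔ A s) (subst (λ v → D v ⊆ A) u≡2^s D⊆A))
    where
    x≡s : x ≡ s
    x≡s = ∣m-n∣≡0⇒m≡n (m+n≡0⇒m≡0 _ e)
    u≡2^s : u ≡ 2 ^ s
    u≡2^s = ∣m-n∣≡0⇒m≡n (m+n≡0⇒n≡0 ∣ x - s ∣ e)
  complete : A x → ΨRel idAxioms A x
  complete x∈A = 2 ^ x , (x , cong₂ _+_ (∣n-n∣≡0 x) (∣n-n∣≡0 (2 ^ x))) , proj₂ (D-2^⊆⇔ A x) x∈A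

χEntry : ℕ → ℕ → ℕ
χEntry c k = b2n (does (entry c (unpair₁ k) ≟ unpair₂ k))

χCode : ℕ → ℕ → ℕ
χCode c n = code (χEntry c ↾ n)

χCode-code : ∀ τ n → χCode (code τ) n ≡ codeB (χ-graph τ ↾ n)
χCode-code τ n = cong code (trans
  (applyUpTo-cong _ _ n (λ k _ → cong (λ a → b2n (does (a ≟ unpair₂ k))) (entry-code τ (unpair₁ k))))
  (sym (map-applyUpTo (χ-graph τ) b2n n)))

prefixCode : ℕ → ℕ → ℕ
prefixCode c m = code (entry c ↾ m)

prefixCode-code : ∀ τ m → prefixCode (code τ) m ≡ code ((τ !_) ↾ m)
prefixCode-code τ m = cong code (applyUpTo-cong _ _ m (λ k _ → entry-code τ k))

-- The witness ⟨ c , ⟨ n , s ⟩ ⟩ names the string τ coded by c, a witness s that R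
-- enumerates c from u, and a length n ≤ length τ; x must code χ-graph τ ↾ n.
χTreeAxioms : (ℕ → ℕ → ℕ → ℕ) → ℕ → ℕ → ℕ → ℕ
χTreeAxioms R x u w = ∣ x - χCode c n ∣ + lengthBelow c n + R c u s
  where
  c n s : ℕ
  c = unpair₁ w
  n = unpair₁ (unpair₂ w)
  s = unpair₂ (unpair₂ w)

χTreeAxioms-⟨,⟩ : ∀ R x u c n s →
  χTreeAxioms R x u ⟨ c , ⟨ n , s ⟩ ⟩ ≡ ∣ x - χCode c n ∣ + lengthBelow c n + R c u s
χTreeAxioms-⟨,⟩ R x u c n s
  rewrite unpair₁-⟨,⟩ c ⟨ n , s ⟩ | unpair₂-⟨,⟩ c ⟨ n , s ⟩ | unpair₁-⟨,⟩ n s | unpair₂-⟨,⟩ n s = refl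

ΨRel-χTreeAxioms : ∀ T R A → ΨRel R A ≐ codesN T → ΨRel (χTreeAxioms R) A ≐ codesB (χTree T)
ΨRel-χTreeAxioms T R A ΨR≐T x = sound , complete
  where
  sound : ΨRel (χTreeAxioms R) A x → codesB (χTree T) x
  sound (u , (w , e) , D⊆A) with proj₁ (ΨR≐T (unpair₁ w)) (u , (_ , m+n≡0⇒n≡0 _ e) , D⊆A)
  ... | τ , τ≡c , τ∈T =
    χ-graph τ ↾ n , sym (trans x≡ (trans (cong (λ c → χCode c n) (sym τ≡c)) (χCode-code τ n))) ,
    χ-graph↾∈χTree τ∈T (lengthBelow≡0⇒≤ τ n (trans (cong (λ c → lengthBelow c n) τ≡c) (m+n≡0⇒n≡0 _ e₁)))
    where
    n : ℕ
    n = unpair₁ (unpair₂ w)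
    e₁ : ∣ x - χCode (unpair₁ w) n ∣ + lengthBelow (unpair₁ w) n ≡ 0
    e₁ = m+n≡0⇒m≡0 _ e
    x≡ : x ≡ χCode (unpair₁ w) n
    x≡ = ∣m-n∣≡0⇒m≡n (m+n≡0⇒m≡0 _ e₁)
  complete : codesB (χTree T) x → ΨRel (χTreeAxioms R) A x
  complete (σ , refl , τ , τ∈T , σ≤ , σ≡) with proj₂ (ΨR≐T (code τ)) (τ , refl , τ∈T)
  ... | u , (s , e) , D⊆A = u , (⟨ code τ , ⟨ length σ , s ⟩ ⟩ , axiom) , D⊆A
    where
    χCode≡ : χCode (code τ) (length σ) ≡ codeB σ
    χCode≡ = trans (χCode-code τ (length σ)) (cong codeB (sym σ≡))
    axiom : χTreeAxioms R (codeB σ) u ⟨ code τ , ⟨ length σ , s ⟩ ⟩ ≡ 0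
    axiom = trans (χTreeAxioms-⟨,⟩ R (codeB σ) u (code τ) (length σ) s)
      (cong₂ _+_ (cong₂ _+_ (trans (cong (∣ codeB σ -_∣) χCode≡) (∣n-n∣≡0 (codeB σ))) (≤⇒lengthBelow≡0 τ _ σ≤)) e)

χTree⇒applyUpTo-!∈ : ∀ {T} → IsTree T → ∀ τ m →
  χTree T (χ-graph τ ↾ suc ⟨ code ((τ !_) ↾ m) , code ((τ !_) ↾ m) ⟩) → T ((τ !_) ↾ m)
χTree⇒applyUpTo-!∈ {T} tree τ m χτ∈S with χTree-agreeing (χ-graph τ) _ χτ∈S
... | τ′ , τ′∈T , N≤ , χτ≡χτ′ = subst T (sym ρ≡) (applyUpTo-!∈ tree τ′ (length ρ) τ′∈T |ρ|≤|τ′|)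
  where
  ρ : List ℕ
  ρ = (τ !_) ↾ m
  ρ⊆χτ : ∀ i → i < length ρ → χ-graph τ ⟨ i , ρ ! i ⟩ ≡ true
  ρ⊆χτ i i< = subst (λ a → χ-graph τ ⟨ i , a ⟩ ≡ true)
    (sym (!-applyUpTo (τ !_) m i (subst (i <_) (length-applyUpTo _ m) i<))) (χ-graph-self τ i)
  |ρ|≤|τ′| : length ρ ≤ length τ′
  |ρ|≤|τ′| = ≤-trans (≤-trans (length≤code ρ) (≤-trans (m≤⟨m,n⟩ _ (code ρ)) (n≤1+n _))) N≤
  ρ≡ : ρ ≡ (τ′ !_) ↾ length ρ
  ρ≡ = χ-agreement⇒≡applyUpTo (χ-graph τ) τ′ ρ _ χτ≡χτ′ ≤-refl ρ⊆χτ

-- The witness ⟨ c , m ⟩ names the string τ coded by c, with x the code of τ ↾ m, and u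
-- must be the singleton of the code of χ-graph τ ↾ (1 + ⟨ x , x ⟩): that segment
-- already determines τ ↾ m, so any string of T it comes from extends τ ↾ m.
fromχTreeAxioms : ℕ → ℕ → ℕ → ℕ
fromχTreeAxioms x u w = ∣ x - prefixCode c m ∣ + ∣ u - 2 ^ χCode c (suc ⟨ x , x ⟩) ∣
  where
  c m : ℕ
  c = unpair₁ w
  m = unpair₂ w

fromχTreeAxioms-⟨,⟩ : ∀ x u c m →
  fromχTreeAxioms x u ⟨ c , m ⟩ ≡ ∣ x - prefixCode c m ∣ + ∣ u - 2 ^ χCode c (suc ⟨ x , x ⟩) ∣
fromχTreeAxioms-⟨,⟩ x u c m rewrite unpair₁-⟨,⟩ c m | unpair₂-⟨,⟩ c m = refl

ΨRel-fromχTreeAxioms : ∀ T → IsTree T → NoLeaves T → ΨRel fromχTreeAxioms (codesB (χTree T)) ≐ codesN T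
ΨRel-fromχTreeAxioms T tree noLeaves x = sound , complete
  where
  N : ℕ
  N = suc ⟨ x , x ⟩
  sound : ΨRel fromχTreeAxioms (codesB (χTree T)) x → codesN T x
  sound (u , (w , e) , D⊆S) with code-surjective (unpair₁ w)
  ... | τ , τ≡c =
    ρ , sym x≡ , χTree⇒applyUpTo-!∈ tree τ m (subst (λ y → χTree T (χ-graph τ ↾ suc ⟨ y , y ⟩)) x≡ χτ↾N∈S)
    where
    m : ℕ
    m = unpair₂ w
    ρ : List ℕ
    ρ = (τ !_) ↾ m
    x≡ : x ≡ code ρ
    x≡ = trans (∣m-n∣≡0⇒m≡n (m+n≡0⇒m≡0 _ e))
               (trans (cong (λ c → prefixCode c m) (sym τ≡c)) (prefixCode-code τ m))
    u≡ : u ≡ 2 ^ codeB (χ-graph τ ↾ N)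
    u≡ = trans (∣m-n∣≡0⇒m≡n (m+n≡0⇒n≡0 _ e))
               (cong (2 ^_) (trans (cong (λ c → χCode c N) (sym τ≡c)) (χCode-code τ N)))
    χτ↾N∈S : χTree T (χ-graph τ ↾ N)
    χτ↾N∈S = singleton⊆codesB (χTree T) _ (subst (λ v → D v ⊆ codesB (χTree T)) u≡ D⊆S)
  complete : codesN T x → ΨRel fromχTreeAxioms (codesB (χTree T)) x
  complete (τ₀ , refl , τ₀∈T) with extendBy noLeaves τ₀ τ₀∈T N
  ... | ρ , τ∈T , |ρ|≡N = 2 ^ codeB (χ-graph τ ↾ N) , (⟨ code τ , m ⟩ , axiom) ,
                          proj₂ (D-2^⊆⇔ _ _) (χ-graph τ ↾ N , refl , χ-graph↾∈χTree τ∈T N≤|τ|)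
    where
    τ : List ℕ
    τ = τ₀ ++ ρ
    m : ℕ
    m = length τ₀
    N≤|τ| : N ≤ length τ
    N≤|τ| = subst (N ≤_) (sym (trans (length-++ τ₀) (cong (m +_) |ρ|≡N))) (m≤n+m N m)
    prefix≡ : prefixCode (code τ) m ≡ code τ₀
    prefix≡ = trans (prefixCode-code τ m)
      (cong code (trans (applyUpTo-cong _ _ m (λ i i< → !-++ˡ τ₀ ρ i i<)) (applyUpTo-!-length τ₀)))
    axiom : fromχTreeAxioms (code τ₀) (2 ^ codeB (χ-graph τ ↾ N)) ⟨ code τ , m ⟩ ≡ 0
    axiom = trans (fromχTreeAxioms-⟨,⟩ (code τ₀) (2 ^ codeB (χ-graph τ ↾ N)) (code τ) m)
      (cong₂ _+_ (trans (cong (∣ code τ₀ -_∣) prefix≡) (∣n-n∣≡0 (code τ₀)))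
                 (trans (cong (λ v → ∣ 2 ^ codeB (χ-graph τ ↾ N) - 2 ^ v ∣) (χCode-code τ N))
                        (∣n-n∣≡0 (2 ^ codeB (χ-graph τ ↾ N)))))

record PrimRec {n} (f : Vec ℕ n → ℕ) : Set where
  field
    prog    : PR n
    correct : ∀ xs → eval prog xs ≡ f xs
open PrimRec

uncurry₁ : (ℕ → ℕ) → Vec ℕ 1 → ℕ
uncurry₁ f (a ∷ []) = f a

uncurry₂ : (ℕ → ℕ → ℕ) → Vec ℕ 2 → ℕ
uncurry₂ f (a ∷ b ∷ []) = f a b

⟦_⟧ : ∀ {n} {f : Vec ℕ n → ℕ} → PrimRec f → Vec ℕ n → ℕ
⟦_⟧ {f = f} _ = f

pr-≗ : ∀ {n} {f g : Vec ℕ n → ℕ} → (∀ xs → f xs ≡ g xs) → PrimRec f → PrimRec g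
pr-≗ f≗g F = record { prog = prog F ; correct = λ xs → trans (correct F xs) (f≗g xs) }

pr-eval : ∀ {n} (p : PR n) → PrimRec (eval p)
pr-eval p = record { prog = p ; correct = λ _ → refl }

pr-const : ∀ {n} k → PrimRec {n} (λ _ → k)
pr-const zero    = record { prog = zer ; correct = λ _ → refl }
pr-const (suc k) = record
  { prog = comp succ (prog (pr-const k) ∷ []) ; correct = λ xs → cong suc (correct (pr-const k) xs) }

pr-suc : PrimRec (uncurry₁ suc)
pr-suc = record { prog = succ ; correct = λ { (a ∷ []) → refl } }

pr-proj : ∀ {n} (i : Fin n) → PrimRec (λ xs → lookup xs i)
pr-proj i = record { prog = proj i ; correct = λ _ → refl }

x₀ : ∀ {n} → PrimRec {suc n} (λ xs → lookup xs (# 0))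
x₀ = pr-proj (# 0)

x₁ : ∀ {n} → PrimRec {suc (suc n)} (λ xs → lookup xs (# 1))
x₁ = pr-proj (# 1)

pr-∘₁ : ∀ {n f} {g : Vec ℕ n → ℕ} → PrimRec f → PrimRec g → PrimRec (λ xs → f (g xs ∷ []))
pr-∘₁ F G = record
  { prog = comp (prog F) (prog G ∷ [])
  ; correct = λ xs → trans (cong (λ a → eval (prog F) (a ∷ [])) (correct G xs)) (correct F _) }

pr-∘₂ : ∀ {n f} {g h : Vec ℕ n → ℕ} → PrimRec f → PrimRec g → PrimRec h → PrimRec (λ xs → f (g xs ∷ h xs ∷ []))
pr-∘₂ F G H = record
  { prog = comp (prog F) (prog G ∷ prog H ∷ [])
  ; correct = λ xs → trans (cong₂ (λ a b → eval (prog F) (a ∷ b ∷ [])) (correct G xs) (correct H xs)) (correct F _) }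

pr-∘₃ : ∀ {n f} {g h k : Vec ℕ n → ℕ} → PrimRec f → PrimRec g → PrimRec h → PrimRec k →
  PrimRec (λ xs → f (g xs ∷ h xs ∷ k xs ∷ []))
pr-∘₃ F G H K = record
  { prog = comp (prog F) (prog G ∷ prog H ∷ prog K ∷ [])
  ; correct = λ xs → trans (cong₂ (λ a b → eval (prog F) (a ∷ b ∷ eval (prog K) xs ∷ [])) (correct G xs) (correct H xs))
                           (trans (cong (λ c → eval (prog F) (_ ∷ _ ∷ c ∷ [])) (correct K xs)) (correct F _)) }

primRec : ∀ {n} → (Vec ℕ n → ℕ) → (Vec ℕ (suc (suc n)) → ℕ) → Vec ℕ (suc n) → ℕ
primRec g h (zero  ∷ xs) = g xs
primRec g h (suc k ∷ xs) = h (k ∷ primRec g h (k ∷ xs) ∷ xs)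

pr-rec : ∀ {n g h} → PrimRec {n} g → PrimRec h → PrimRec (primRec g h)
pr-rec {g = g} {h} G H = record { prog = prec (prog G) (prog H) ; correct = λ { (k ∷ xs) → evalRec≡ k xs } }
  where
  evalRec≡ : ∀ k xs → evalRec (prog G) (prog H) k xs ≡ primRec g h (k ∷ xs)
  evalRec≡ zero    xs = correct G xs
  evalRec≡ (suc k) xs = trans (cong (λ r → eval (prog H) (k ∷ r ∷ xs)) (evalRec≡ k xs)) (correct H _)

pr-+ : PrimRec (uncurry₂ _+_)
pr-+ = pr-≗ (λ { (a ∷ b ∷ []) → +≡ a b }) (pr-rec x₀ (pr-∘₁ pr-suc x₁))
  where
  +≡ : ∀ a b → primRec (λ xs → lookup xs (# 0)) (λ xs → suc (lookup xs (# 1))) (a ∷ b ∷ []) ≡ a + b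
  +≡ zero    b = refl
  +≡ (suc a) b = cong suc (+≡ a b)

pr-pred : PrimRec (uncurry₁ pred)
pr-pred = pr-≗ (λ { (zero ∷ []) → refl ; (suc a ∷ []) → refl }) (pr-rec (pr-const 0) x₀)

pr-∸ : PrimRec (uncurry₂ _∸_)
pr-∸ = pr-≗ (λ { (a ∷ b ∷ []) → ∸≡ b a }) (pr-∘₂ (pr-rec x₀ (pr-∘₁ pr-pred x₁)) x₁ x₀)
  where
  ∸≡ : ∀ b a → primRec (λ xs → lookup xs (# 0)) (λ xs → pred (lookup xs (# 1))) (b ∷ a ∷ []) ≡ a ∸ b
  ∸≡ zero    a = refl
  ∸≡ (suc b) a = trans (cong pred (∸≡ b a)) (pred[m∸n]≡m∸[1+n] a b)

pr-isZero : PrimRec (uncurry₁ isZero)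
pr-isZero = pr-≗ (λ { (zero ∷ []) → refl ; (suc a ∷ []) → refl }) (pr-rec (pr-const 1) (pr-const 0))

pr-∣-∣ : PrimRec (uncurry₂ ∣_-_∣)
pr-∣-∣ = pr-≗ (λ { (a ∷ b ∷ []) → ∸+∸≡∣-∣ a b }) (pr-∘₂ pr-+ (pr-∘₂ pr-∸ x₀ x₁) (pr-∘₂ pr-∸ x₁ x₀))

pr-≟ : PrimRec (uncurry₂ (λ a b → b2n (does (a ≟ b))))
pr-≟ = pr-≗ (λ { (a ∷ b ∷ []) → isZero-∣-∣ a b }) (pr-∘₁ pr-isZero pr-∣-∣)

pr-tri : PrimRec (uncurry₁ tri)
pr-tri = pr-≗ (λ { (a ∷ []) → tri≡ a }) (pr-rec (pr-const 0) (pr-∘₂ pr-+ x₁ (pr-∘₁ pr-suc x₀)))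
  where
  tri≡ : ∀ a → primRec (λ _ → 0) (λ xs → lookup xs (# 1) + suc (lookup xs (# 0))) (a ∷ []) ≡ tri a
  tri≡ zero    = refl
  tri≡ (suc a) = cong (_+ suc a) (tri≡ a)

pr-⟨,⟩ : PrimRec (uncurry₂ ⟨_,_⟩)
pr-⟨,⟩ = pr-≗ (λ { (a ∷ b ∷ []) → refl }) (pr-∘₂ pr-+ (pr-∘₁ pr-tri pr-+) x₁)

pr-diag : PrimRec (uncurry₁ diag)
pr-diag = pr-≗ (λ { (a ∷ []) → diag≡ a })
  (pr-rec (pr-const 0) (pr-∘₂ pr-+ x₁ (pr-∘₂ pr-≟ (pr-∘₁ pr-suc x₀) (pr-∘₁ pr-tri (pr-∘₁ pr-suc x₁)))))
  where
  diag≡ : ∀ a → primRec (λ _ → 0) (λ xs → lookup xs (# 1) + b2n (does (suc (lookup xs (# 0)) ≟ tri (suc (lookup xs (# 1))))))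
                        (a ∷ []) ≡ diag a
  diag≡ zero    = refl
  diag≡ (suc a) rewrite diag≡ a = refl

pr-unpair₂ : PrimRec (uncurry₁ unpair₂)
pr-unpair₂ = pr-≗ (λ { (a ∷ []) → refl }) (pr-∘₂ pr-∸ x₀ (pr-∘₁ pr-tri pr-diag))

pr-unpair₁ : PrimRec (uncurry₁ unpair₁)
pr-unpair₁ = pr-≗ (λ { (a ∷ []) → refl }) (pr-∘₂ pr-∸ pr-diag pr-unpair₂)

pr-tl^ : PrimRec (uncurry₂ tl^)
pr-tl^ = pr-≗ (λ { (j ∷ c ∷ []) → tl^≡ j c }) (pr-rec x₀ (pr-∘₁ pr-unpair₂ (pr-∘₁ pr-pred x₁)))
  where
  tl^≡ : ∀ j c → primRec (λ xs → lookup xs (# 0)) (λ xs → tl (lookup xs (# 1))) (j ∷ c ∷ []) ≡ tl^ j c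
  tl^≡ zero    c = refl
  tl^≡ (suc j) c = cong tl (tl^≡ j c)

pr-entry : PrimRec (uncurry₂ entry)
pr-entry = pr-≗ (λ { (c ∷ i ∷ []) → refl }) (pr-∘₁ pr-unpair₁ (pr-∘₁ pr-pred (pr-∘₂ pr-tl^ x₁ x₀)))

pr-2^ : PrimRec (uncurry₁ (2 ^_))
pr-2^ = pr-≗ (λ { (a ∷ []) → 2^≡ a }) (pr-rec (pr-const 1) (pr-∘₂ pr-+ x₁ x₁))
  where
  2^≡ : ∀ a → primRec (λ _ → 1) (λ xs → lookup xs (# 1) + lookup xs (# 1)) (a ∷ []) ≡ 2 ^ a
  2^≡ zero    = refl
  2^≡ (suc a) rewrite 2^≡ a = cong (2 ^ a +_) (sym (+-identityʳ (2 ^ a)))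

pr-lengthBelow : PrimRec (uncurry₂ lengthBelow)
pr-lengthBelow = pr-≗ (λ { (c ∷ n ∷ []) → refl })
  (pr-∘₁ pr-isZero (pr-∘₂ pr-+ (pr-∘₁ pr-isZero x₁) (pr-∘₂ pr-tl^ (pr-∘₁ pr-pred x₁) x₀)))

codeSuffix : (ℕ → ℕ) → ℕ → ℕ → ℕ
codeSuffix G n zero    = 0
codeSuffix G n (suc j) = suc ⟨ G (n ∸ suc j) , codeSuffix G n j ⟩

codeSuffix≡ : ∀ G n j → j ≤ n → codeSuffix G n j ≡ code ((λ i → G (n ∸ j + i)) ↾ j)
codeSuffix≡ G n zero    _  = refl
codeSuffix≡ G n (suc j) j<n = cong suc (cong₂ ⟨_,_⟩ (cong G (sym (+-identityʳ (n ∸ suc j))))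
  (trans (codeSuffix≡ G n j (<⇒≤ j<n)) (cong code (applyUpTo-cong _ _ j (λ k _ → cong G index≡)))))
  where
  index≡ : ∀ {k} → n ∸ j + k ≡ n ∸ suc j + suc k
  index≡ {k} = trans (cong (_+ k) (+-∸-assoc 1 j<n)) (sym (+-suc (n ∸ suc j) k))

-- Primitive recursion prepends, so the code of G ↾ n is assembled from its last entry backwards.
pr-codeUpTo : ∀ {F} → PrimRec (uncurry₂ F) → PrimRec (uncurry₂ (λ n c → code ((λ k → F k c) ↾ n)))
pr-codeUpTo {F} pr-F = pr-≗ (λ { (n ∷ c ∷ []) → code≡ n c }) (pr-∘₃ suffix x₀ x₀ x₁)
  where
  suffix : PrimRec (primRec (λ _ → 0) (λ xs →
             suc ⟨ F (lookup xs (# 2) ∸ suc (lookup xs (# 0))) (lookup xs (# 3)) , lookup xs (# 1) ⟩))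
  suffix = pr-rec (pr-const 0) (pr-∘₁ pr-suc (pr-∘₂ pr-⟨,⟩
             (pr-∘₂ pr-F (pr-∘₂ pr-∸ (pr-proj (# 2)) (pr-∘₁ pr-suc x₀)) (pr-proj (# 3))) x₁))
  suffix≡ : ∀ j n c → ⟦ suffix ⟧ (j ∷ n ∷ c ∷ []) ≡ codeSuffix (λ k → F k c) n j
  suffix≡ zero    n c = refl
  suffix≡ (suc j) n c = cong (λ r → suc ⟨ F (n ∸ suc j) c , r ⟩) (suffix≡ j n c)
  code≡ : ∀ n c → ⟦ suffix ⟧ (n ∷ n ∷ c ∷ []) ≡ code ((λ k → F k c) ↾ n)
  code≡ n c = trans (suffix≡ n n c) (trans (codeSuffix≡ _ n n ≤-refl)
    (cong code (applyUpTo-cong _ _ n (λ k _ → cong (λ i → F (i + k) c) (n∸n≡0 n)))))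

pr-χCode : PrimRec (uncurry₂ χCode)
pr-χCode = pr-≗ (λ { (c ∷ n ∷ []) → refl }) (pr-∘₂ (pr-codeUpTo pr-χEntry) x₁ x₀)
  where
  pr-χEntry : PrimRec (uncurry₂ (λ k c → χEntry c k))
  pr-χEntry = pr-≗ (λ { (k ∷ c ∷ []) → refl })
    (pr-∘₂ pr-≟ (pr-∘₂ pr-entry x₁ (pr-∘₁ pr-unpair₁ x₀)) (pr-∘₁ pr-unpair₂ x₀))

pr-prefixCode : PrimRec (uncurry₂ prefixCode)
pr-prefixCode = pr-≗ (λ { (c ∷ m ∷ []) → refl })
  (pr-∘₂ (pr-codeUpTo (pr-≗ (λ { (k ∷ c ∷ []) → refl }) (pr-∘₂ pr-entry x₁ x₀))) x₁ x₀)

relFun : (ℕ → ℕ → ℕ → ℕ) → Vec ℕ 2 → ℕ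
relFun R (z ∷ s ∷ []) = R (unpair₁ z) (unpair₂ z) s

Ψ-PrimRec : ∀ {R} (q : PrimRec (relFun R)) A → Ψ (prog q) A ≐ ΨRel R A
Ψ-PrimRec {R} q A x = (λ { (u , (s , e) , D⊆A) → u , (s , trans (sym (axiom≡ u s)) e) , D⊆A }) ,
                      (λ { (u , (s , e) , D⊆A) → u , (s , trans (axiom≡ u s) e) , D⊆A })
  where
  axiom≡ : ∀ u s → eval (prog q) (⟨ x , u ⟩ ∷ s ∷ []) ≡ R x u s
  axiom≡ u s rewrite correct q (⟨ x , u ⟩ ∷ s ∷ []) | unpair₁-⟨,⟩ x u | unpair₂-⟨,⟩ x u = refl

pr-idAxioms : PrimRec (relFun idAxioms)
pr-idAxioms = pr-≗ (λ { (z ∷ s ∷ []) → refl })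
  (pr-∘₂ pr-+ (pr-∘₂ pr-∣-∣ (pr-∘₁ pr-unpair₁ x₀) x₁) (pr-∘₂ pr-∣-∣ (pr-∘₁ pr-unpair₂ x₀) (pr-∘₁ pr-2^ x₁)))

pr-χTreeAxioms : ∀ p → PrimRec (relFun (χTreeAxioms (axiomsOf p)))
pr-χTreeAxioms p = pr-≗ (λ { (z ∷ w ∷ []) → refl })
  (pr-∘₂ pr-+ (pr-∘₂ pr-+ (pr-∘₂ pr-∣-∣ (pr-∘₁ pr-unpair₁ x₀) (pr-∘₂ pr-χCode c n)) (pr-∘₂ pr-lengthBelow c n))
              (pr-∘₂ (pr-eval p) (pr-∘₂ pr-⟨,⟩ c (pr-∘₁ pr-unpair₂ x₀)) s))
  where
  c : PrimRec {2} (λ xs → unpair₁ (lookup xs (# 1)))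
  c = pr-∘₁ pr-unpair₁ x₁
  n : PrimRec {2} (λ xs → unpair₁ (unpair₂ (lookup xs (# 1))))
  n = pr-∘₁ pr-unpair₁ (pr-∘₁ pr-unpair₂ x₁)
  s : PrimRec {2} (λ xs → unpair₂ (unpair₂ (lookup xs (# 1))))
  s = pr-∘₁ pr-unpair₂ (pr-∘₁ pr-unpair₂ x₁)

pr-fromχTreeAxioms : PrimRec (relFun fromχTreeAxioms)
pr-fromχTreeAxioms = pr-≗ (λ { (z ∷ w ∷ []) → refl })
  (pr-∘₂ pr-+ (pr-∘₂ pr-∣-∣ x (pr-∘₂ pr-prefixCode c (pr-∘₁ pr-unpair₂ x₁)))
              (pr-∘₂ pr-∣-∣ (pr-∘₁ pr-unpair₂ x₀) (pr-∘₁ pr-2^ (pr-∘₂ pr-χCode c (pr-∘₁ pr-suc (pr-∘₂ pr-⟨,⟩ x x))))))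
  where
  x : PrimRec {2} (λ xs → unpair₁ (lookup xs (# 0)))
  x = pr-∘₁ pr-unpair₁ x₀
  c : PrimRec {2} (λ xs → unpair₁ (lookup xs (# 1)))
  c = pr-∘₁ pr-unpair₁ x₁

identityOperator : PR 2
identityOperator = prog pr-idAxioms

χTreeOperator : PR 2 → PR 2
χTreeOperator q = prog (pr-χTreeAxioms q)

fromχTreeOperator : PR 2
fromχTreeOperator = prog pr-fromχTreeAxioms

Ψ-identityOperator : ∀ A → Ψ identityOperator A ≐ A
Ψ-identityOperator A = ≐-trans (Ψ-PrimRec pr-idAxioms A) (ΨRel-idAxioms A)

Ψ-χTreeOperator : ∀ T q A → Ψ q A ≐ codesN T → Ψ (χTreeOperator q) A ≐ codesB (χTree T)
Ψ-χTreeOperator T q A Ψq≐T = ≐-trans (Ψ-PrimRec (pr-χTreeAxioms q) A) (ΨRel-χTreeAxioms T (axiomsOf q) A Ψq≐T)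

Ψ-fromχTreeOperator : ∀ T → IsTree T → NoLeaves T → Ψ fromχTreeOperator (codesB (χTree T)) ≐ codesN T
Ψ-fromχTreeOperator T tree noLeaves =
  ≐-trans (Ψ-PrimRec pr-fromχTreeAxioms _) (ΨRel-fromχTreeAxioms T tree noLeaves)

χTree-paths : ∀ T → IsTree T → FinitelyBranching T →
  ∀ h → IsPath (χTree T) h ⇔ (∃ λ f → IsPath T f × IsChar h (graph f))
χTree-paths T tree finBranching h =
  (λ h∈[S] → let open χTreePath T tree finBranching h h∈[S] in f , f∈[T] , h-char) ,
  (λ { (f , f∈[T] , h-char) → χTree-path-of-graph f h f∈[T] h-char })

proposition12 : (T : List ℕ → Set) → UEPointedFuns T →
    Σ (List Bool → Set) λ S →
      UEPointedSets S × (codesB S ≡e codesN T) ×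
      (∀ (h : ℕ → Bool) → IsPath S h ⇔ (∃ λ f → IsPath T f × IsChar h (graph f)))
proposition12 T (tree , finBranching , noLeaves , p , Ψp≐T) =
  χTree T ,
  (χTree-isTree T , χTree-noLeaves noLeaves , χTreeOperator p , uniform) ,
  (S≤eT , (fromχTreeOperator , Ψ-fromχTreeOperator T tree noLeaves)) ,
  χTree-paths T tree finBranching
  where
  uniform : ∀ h → IsPath (χTree T) h → Ψ (χTreeOperator p) (h ⁺) ≐ codesB (χTree T)
  uniform h h∈[S] with proj₁ (χTree-paths T tree finBranching h) h∈[S]
  ... | f , f∈[T] , h-char = Ψ-χTreeOperator T p (h ⁺) (≐-trans (Ψ-cong p h-char) (Ψp≐T f f∈[T]))
  S≤eT : codesB (χTree T) ≤e codesN T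
  S≤eT = χTreeOperator identityOperator ,
         Ψ-χTreeOperator T identityOperator (codesN T) (Ψ-identityOperator (codesN T))
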